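{- Let $\alpha$ and $x$ be indeterminates. Let $\mathsf{L}^{(\alpha)}=(\ell_{n,k})_{n,k\ge0}$ be the unit-lower-triangular matrix with $\ell_{n,k}=\binom{n}{k}(n+\alpha)^{\underline{n-k}}$ for $0\le k\le n$, and let $B_x=(\binom{i}{j}x^{i-j})_{i,j\ge0}$. (a) The production matrix of $\mathsf{L}^{(\alpha)}$ is the tridiagonal matrix $P^\circ=(p^\circ_{ij})_{i,j\ge0}$ with $p^\circ_{n,n+1}=1$, $p^\circ_{n,n}=2n+1+\alpha$, $p^\circ_{n,n-1}=n(n+\alpha)$, and $p^\circ_{n,k}=0$ if $k<n-1$ or $k>n+1$. (b) The production matrix of $\mathsf{L}^{(\alpha)}B_x$ is the matrix $P=(p_{ij})_{i,j\ge0}$ with $p_{n,n+1}=1$, $p_{n,n}=2n+1+\alpha+x$, $p_{n,n-1}=n(n+\alpha)+2nx$, $p_{n,n-2}=n(n-1)x$, and $p_{n,k}=0$ if $k<n-2$ or $k>n+1$.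
   Context: $\rho^{\underline{m}}=\rho(\rho-1)\cdots(\rho-m+1)$ (falling power). For a row-finite matrix $P=(p_{ij})_{i,j\ge0}$, its output matrix $\mathcal{O}(P)$ has entries $\mathcal{O}(P)_{nk}=(P^n)_{0k}$. A matrix $P$ is the production matrix of a matrix $A$ if $A=\mathcal{O}(P)$; for unit-lower-triangular $A$ this is equivalent to $P=A^{ -1}\Delta A$, where $\Delta$ has entries $1$ on the superdiagonal and $0$ elsewhere. -}

module Defs where

import Level
open import Algebra.Bundles using (CommutativeRing)
open import Data.Nat as ℕ using (ℕ; zero; suc; _∸_; _≤?_; _<_; _≟_)
open import Data.Nat.Combinatorics using (_C_)
open import Data.Nat.Properties using (n<1+n; <-irrefl; <-trans; m<n⇒m<1+n)
open import Relation.Nullary using (yes; no)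
open import Relation.Binary.PropositionalEquality using (_≡_; refl)
open import Data.Product using (_×_; _,_; proj₁; proj₂)
open import Data.Empty using (⊥-elim)

module _ {c ℓ} (R : CommutativeRing c ℓ) where
  open CommutativeRing R hiding (refl)
  open CommutativeRing R using () renaming (refl to ≈-refl)

  Matrix : Set c
  Matrix = ℕ → ℕ → Carrier

  nat : ℕ → Carrier
  nat zero    = 0#
  nat (suc n) = 1# + nat n

  pow : Carrier → ℕ → Carrier
  pow y zero    = 1#
  pow y (suc m) = pow y m * y

  falling : Carrier → ℕ → Carrier
  falling y zero    = 1#
  falling y (suc m) = falling y m * (y - nat m)

  sumTo : ℕ → (ℕ → Carrier) → Carrier
  sumTo zero    f = f 0
  sumTo (suc s) f = sumTo s f + f (suc s)

  maxTo : ℕ → (ℕ → ℕ) → ℕ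
  maxTo zero    b = b 0
  maxTo (suc s) b = maxTo s b ℕ.⊔ b (suc s)

  record RowFinite : Set (c Level.⊔ ℓ) where
    field
      entry  : Matrix
      bound  : ℕ → ℕ
      vanish : ∀ i j → bound i < j → entry i j ≈ 0#
  open RowFinite public

  -- row 0 of P^n, together with an index beyond which it vanishes
  row0Pow : RowFinite → ℕ → ℕ × (ℕ → Carrier)
  row0Pow P zero = 0 , (λ { zero → 1# ; (suc _) → 0# })
  row0Pow P (suc n) with row0Pow P n
  ... | s , v = maxTo s (bound P) , (λ k → sumTo s (λ j → v j * entry P j k))

  output : RowFinite → Matrix
  output P n k = proj₂ (row0Pow P n) k

  IsProductionMatrixOf : RowFinite → Matrix → Set ℓ
  IsProductionMatrixOf P A = ∀ n k → output P n k ≈ A n k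

  Lα : Carrier → Matrix
  Lα α n k with k ≤? n
  ... | yes _ = nat (n C k) * falling (nat n + α) (n ∸ k)
  ... | no  _ = 0#

  Bx : Carrier → Matrix
  Bx x i j with j ≤? i
  ... | yes _ = nat (i C j) * pow x (i ∸ j)
  ... | no  _ = 0#

  -- product of a lower-triangular matrix A with a matrix B: (AB)_{nk} = Σ_{j≤n} A_{nj} B_{jk}
  lowerMul : Matrix → Matrix → Matrix
  lowerMul A B n k = sumTo n (λ j → A n j * B j k)

  band : (f₁ f₀ f₋₁ f₋₂ : ℕ → Carrier) → Matrix
  band f₁ f₀ f₋₁ f₋₂ n k with k ≟ suc n
  ... | yes _ = f₁ n
  ... | no _ with k ≟ n
  ...   | yes _ = f₀ n
  ...   | no _ with suc k ≟ n
  ...     | yes _ = f₋₁ n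
  ...     | no _ with suc (suc k) ≟ n
  ...       | yes _ = f₋₂ n
  ...       | no _ = 0#

  band-vanish : ∀ f₁ f₀ f₋₁ f₋₂ i j → suc i < j → band f₁ f₀ f₋₁ f₋₂ i j ≈ 0#
  band-vanish f₁ f₀ f₋₁ f₋₂ i j h with j ≟ suc i
  ... | yes refl = ⊥-elim (<-irrefl refl h)
  ... | no _ with j ≟ i
  ...   | yes refl = ⊥-elim (<-irrefl refl (<-trans (n<1+n j) h))
  ...   | no _ with suc j ≟ i
  ...     | yes refl = ⊥-elim (<-irrefl refl (<-trans (m<n⇒m<1+n (n<1+n j)) h))
  ...     | no _ with suc (suc j) ≟ i
  ...       | yes refl = ⊥-elim (<-irrefl refl
                  (<-trans (m<n⇒m<1+n (m<n⇒m<1+n (n<1+n j))) h))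
  ...       | no _ = ≈-refl

  bandRF : (f₁ f₀ f₋₁ f₋₂ : ℕ → Carrier) → RowFinite
  bandRF f₁ f₀ f₋₁ f₋₂ = record
    { entry = band f₁ f₀ f₋₁ f₋₂ ; bound = suc ; vanish = band-vanish f₁ f₀ f₋₁ f₋₂ }

  Pcirc : Carrier → RowFinite
  Pcirc α = bandRF (λ _ → 1#) (λ n → nat (2 ℕ.* n ℕ.+ 1) + α)
                   (λ n → nat n * (nat n + α)) (λ _ → 0#)

  Pb : Carrier → Carrier → RowFinite
  Pb α x = bandRF (λ _ → 1#) (λ n → nat (2 ℕ.* n ℕ.+ 1) + α + x)
                  (λ n → nat n * (nat n + α) + nat (2 ℕ.* n) * x)
                  (λ n → nat (n ℕ.* (n ∸ 1)) * x)

-- The rows of the output matrix of P satisfy A(n+1) = A(n) P, and a unit-lower-triangular matrix with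
-- this recurrence is O(P).  For (a) the recurrence is the identity
--   ℓ(n+1,k) = ℓ(n,k-1) + (2k+1+α) ℓ(n,k) + (k+1)(k+1+α) ℓ(n,k+1),
-- which follows from Pascal's rule, (1+y)^{\underline{m+1}} = (1+y) y^{\underline{m}}, and the weighted
-- binomial identity (k+1) C(n,k+1) + k C(n,k) = n C(n,k).  For (b), the rows of L B satisfy
-- (LB)(n+1) = L(n) P° B = L(n) B P = (LB)(n) P as soon as P° B = B P; this intertwining is checked
-- entrywise from the recurrences B(n+1,k) = B(n,k-1) + x B(n,k), (k+1) B(n,k+1) = n B(n-1,k) and
-- the weighted identity, which B shares with L.
module Submission where

open import Defs
open import Algebra.Bundles using (CommutativeRing)
import Algebra.Properties.AbelianGroup as AbelianGroupProperties
import Algebra.Solver.Ring.NaturalCoefficients.Default as NaturalCoefficientsSolver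
open import Data.Nat as ℕ using (ℕ; zero; suc; _≤_; _<_; z≤n; s≤s; _∸_; _≟_; _≤?_)
import Data.Nat.Properties as ℕₚ
open import Data.Nat.Combinatorics using (_C_; nC1≡n; nCk+nC[k+1]≡[n+1]C[k+1]; k>n⇒nCk≡0)
open import Data.Nat.Solver using (module +-*-Solver)
open import Data.Product using (_×_; _,_; proj₁; proj₂)
open import Data.Sum using (inj₁; inj₂)
open import Relation.Binary.PropositionalEquality as ≡ using (_≡_; _≢_)
open import Relation.Nullary using (yes; no; contradiction)
open import Function using (_∘_)

[1+k]*[1+n]C[1+k]≡[1+n]*nCk : ∀ n k → suc k ℕ.* (suc n C suc k) ≡ suc n ℕ.* (n C k)
[1+k]*[1+n]C[1+k]≡[1+n]*nCk zero    zero    = ≡.refl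
[1+k]*[1+n]C[1+k]≡[1+n]*nCk zero    (suc k) = ℕₚ.*-zeroʳ (suc (suc k))
[1+k]*[1+n]C[1+k]≡[1+n]*nCk (suc n) zero    =
  ≡.trans (ℕₚ.+-identityʳ _) (≡.trans (nC1≡n (suc (suc n))) (≡.sym (ℕₚ.*-identityʳ _)))
[1+k]*[1+n]C[1+k]≡[1+n]*nCk (suc n) (suc k) = begin
  (2 + k) * ((2 + n) C (2 + k))
    ≡⟨ ≡.cong ((2 + k) *_) (nCk+nC[k+1]≡[n+1]C[k+1] (suc n) (suc k)) ⟨
  (2 + k) * (a + b)
    ≡⟨ solve 3 (λ k a b → (con 2 :+ k) :* (a :+ b) := a :+ (con 1 :+ k) :* a :+ (con 2 :+ k) :* b) ≡.refl k a b ⟩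
  a + (1 + k) * a + (2 + k) * b
    ≡⟨ ≡.cong₂ (λ u v → a + u + v) ([1+k]*[1+n]C[1+k]≡[1+n]*nCk n k) ([1+k]*[1+n]C[1+k]≡[1+n]*nCk n (suc k)) ⟩
  a + (1 + n) * (n C k) + (1 + n) * (n C suc k)
    ≡⟨ solve 4 (λ a n c d → a :+ (con 1 :+ n) :* c :+ (con 1 :+ n) :* d := a :+ (con 1 :+ n) :* (c :+ d))
               ≡.refl a n (n C k) (n C suc k) ⟩
  a + (1 + n) * (n C k + n C suc k)
    ≡⟨ ≡.cong (λ u → a + (1 + n) * u) (nCk+nC[k+1]≡[n+1]C[k+1] n k) ⟩
  (2 + n) * a ∎
  where
  open ≡.≡-Reasoning
  open import Data.Nat.Base using (_+_; _*_)
  open +-*-Solver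
  a = suc n C suc k
  b = suc n C suc (suc k)

[1+k]*nC[1+k]+k*nCk≡n*nCk : ∀ n k → suc k ℕ.* (n C suc k) ℕ.+ k ℕ.* (n C k) ≡ n ℕ.* (n C k)
[1+k]*nC[1+k]+k*nCk≡n*nCk zero    zero    = ≡.refl
[1+k]*nC[1+k]+k*nCk≡n*nCk zero    (suc k) = ≡.cong₂ ℕ._+_ (ℕₚ.*-zeroʳ (2 ℕ.+ k)) (ℕₚ.*-zeroʳ (suc k))
[1+k]*nC[1+k]+k*nCk≡n*nCk (suc n) zero    = ≡.trans (ℕₚ.+-identityʳ _) ([1+k]*[1+n]C[1+k]≡[1+n]*nCk n 0)
[1+k]*nC[1+k]+k*nCk≡n*nCk (suc n) (suc k) = begin
  (2 + k) * (suc n C (2 + k)) + (1 + k) * (suc n C suc k)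
    ≡⟨ ≡.cong₂ _+_ ([1+k]*[1+n]C[1+k]≡[1+n]*nCk n (suc k)) ([1+k]*[1+n]C[1+k]≡[1+n]*nCk n k) ⟩
  (1 + n) * (n C suc k) + (1 + n) * (n C k)
    ≡⟨ solve 3 (λ n c d → (con 1 :+ n) :* d :+ (con 1 :+ n) :* c := (con 1 :+ n) :* (c :+ d)) ≡.refl n (n C k) (n C suc k) ⟩
  (1 + n) * (n C k + n C suc k)
    ≡⟨ ≡.cong ((1 + n) *_) (nCk+nC[k+1]≡[n+1]C[k+1] n k) ⟩
  (1 + n) * (suc n C suc k) ∎
  where
  open ≡.≡-Reasoning
  open import Data.Nat.Base using (_+_; _*_)
  open +-*-Solver

k<n⇒n∸k≡1+[n∸1+k] : ∀ {k n} → k < n → n ∸ k ≡ suc (n ∸ suc k)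
k<n⇒n∸k≡1+[n∸1+k] {k} {suc n} (s≤s k≤n) = ℕₚ.+-∸-assoc 1 k≤n

module _ {c ℓ} (R : CommutativeRing c ℓ) where
  open CommutativeRing R
  open AbelianGroupProperties +-abelianGroup using (xyx⁻¹≈y; ⁻¹-∙-comm; ε⁻¹≈ε)
  open NaturalCoefficientsSolver commutativeSemiring using (solve; _:=_; _:+_; _:*_; con)
  open import Relation.Binary.Reasoning.Setoid setoid

  ι : ℕ → Carrier
  ι = nat R

  ι-cong : ∀ {m n} → m ≡ n → ι m ≈ ι n
  ι-cong ≡.refl = refl

  ι-+ : ∀ m n → ι (m ℕ.+ n) ≈ ι m + ι n
  ι-+ zero    n = sym (+-identityˡ _)
  ι-+ (suc m) n = trans (+-congˡ (ι-+ m n)) (sym (+-assoc _ _ _))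

  ι-* : ∀ m n → ι (m ℕ.* n) ≈ ι m * ι n
  ι-* zero    n = sym (zeroˡ _)
  ι-* (suc m) n = begin
    ι (n ℕ.+ m ℕ.* n)    ≈⟨ ι-+ n (m ℕ.* n) ⟩
    ι n + ι (m ℕ.* n)    ≈⟨ +-congˡ (ι-* m n) ⟩
    ι n + ι m * ι n      ≈⟨ solve 2 (λ a b → a :+ b :* a := (con 1 :+ b) :* a) refl (ι n) (ι m) ⟩
    (1# + ι m) * ι n     ∎

  ι-2* : ∀ n → ι (2 ℕ.* n) ≈ ι n + ι n
  ι-2* n = trans (ι-* 2 n) (solve 1 (λ a → (con 1 :+ (con 1 :+ con 0)) :* a := a :+ a) refl (ι n))

  ι-2*+1 : ∀ n → ι (2 ℕ.* n ℕ.+ 1) ≈ ι n + ι n + 1#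
  ι-2*+1 n = trans (ι-+ (2 ℕ.* n) 1) (+-cong (ι-2* n) (+-identityʳ 1#))

  ι-binomial-weighted : ∀ n k → ι (suc k) * ι (n C suc k) + ι k * ι (n C k) ≈ ι n * ι (n C k)
  ι-binomial-weighted n k = begin
    ι (suc k) * ι (n C suc k) + ι k * ι (n C k)        ≈⟨ +-cong (ι-* (suc k) (n C suc k)) (ι-* k (n C k)) ⟨
    ι (suc k ℕ.* (n C suc k)) + ι (k ℕ.* (n C k))      ≈⟨ ι-+ (suc k ℕ.* (n C suc k)) (k ℕ.* (n C k)) ⟨
    ι (suc k ℕ.* (n C suc k) ℕ.+ k ℕ.* (n C k))        ≈⟨ ι-cong ([1+k]*nC[1+k]+k*nCk≡n*nCk n k) ⟩
    ι (n ℕ.* (n C k))                                  ≈⟨ ι-* n (n C k) ⟩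
    ι n * ι (n C k)                                    ∎

  ι-binomial-absorb : ∀ n k → ι (suc k) * ι (suc n C suc k) ≈ ι (suc n) * ι (n C k)
  ι-binomial-absorb n k = begin
    ι (suc k) * ι (suc n C suc k)    ≈⟨ ι-* (suc k) (suc n C suc k) ⟨
    ι (suc k ℕ.* (suc n C suc k))    ≈⟨ ι-cong ([1+k]*[1+n]C[1+k]≡[1+n]*nCk n k) ⟩
    ι (suc n ℕ.* (n C k))            ≈⟨ ι-* (suc n) (n C k) ⟩
    ι (suc n) * ι (n C k)            ∎

  ι-binomial-pascal : ∀ n k → ι (suc n C suc k) ≈ ι (n C k) + ι (n C suc k)
  ι-binomial-pascal n k = trans (ι-cong (≡.sym (nCk+nC[k+1]≡[n+1]C[k+1] n k))) (ι-+ (n C k) (n C suc k))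

  ι-binomial-above : ∀ {n k} → n < k → ι (n C k) ≈ 0#
  ι-binomial-above n<k = ι-cong (k>n⇒nCk≡0 n<k)

  ∑ : ℕ → (ℕ → Carrier) → Carrier
  ∑ = sumTo R

  syntax ∑ n (λ j → f) = ∑[ j ≤ n ] f

  ∑-cong : ∀ n {f g} → (∀ {j} → j ≤ n → f j ≈ g j) → ∑ n f ≈ ∑ n g
  ∑-cong zero    f≈g = f≈g z≤n
  ∑-cong (suc n) f≈g = +-cong (∑-cong n (λ j≤n → f≈g (ℕₚ.m≤n⇒m≤1+n j≤n))) (f≈g ℕₚ.≤-refl)

  ∑-+ : ∀ n f g → ∑[ j ≤ n ] (f j + g j) ≈ ∑ n f + ∑ n g
  ∑-+ zero    f g = refl
  ∑-+ (suc n) f g = trans (+-congʳ (∑-+ n f g))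
    (solve 4 (λ a b c d → (a :+ b) :+ (c :+ d) := (a :+ c) :+ (b :+ d)) refl _ _ _ _)

  ∑-*ˡ : ∀ n a f → a * ∑ n f ≈ ∑[ j ≤ n ] (a * f j)
  ∑-*ˡ zero    a f = refl
  ∑-*ˡ (suc n) a f = trans (distribˡ _ _ _) (+-congʳ (∑-*ˡ n a f))

  ∑-*ʳ : ∀ n a f → ∑ n f * a ≈ ∑[ j ≤ n ] (f j * a)
  ∑-*ʳ zero    a f = refl
  ∑-*ʳ (suc n) a f = trans (distribʳ _ _ _) (+-congʳ (∑-*ʳ n a f))

  ∑-zero : ∀ n f → (∀ {j} → j ≤ n → f j ≈ 0#) → ∑ n f ≈ 0#
  ∑-zero n f f≈0 = trans (∑-cong n f≈0) (∑0 n)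
    where
    ∑0 : ∀ n → ∑[ j ≤ n ] 0# ≈ 0#
    ∑0 zero    = refl
    ∑0 (suc n) = trans (+-identityʳ _) (∑0 n)

  ∑-extend : ∀ {m n} f → (∀ {j} → m < j → f j ≈ 0#) → m ≤ n → ∑ n f ≈ ∑ m f
  ∑-extend {n = zero}  f vanish z≤n = refl
  ∑-extend {m} {suc n} f vanish m≤1+n with ℕₚ.m≤n⇒m<n∨m≡n m≤1+n
  ... | inj₂ ≡.refl = refl
  ... | inj₁ m<1+n  = begin
    ∑ n f + f (suc n)   ≈⟨ +-cong (∑-extend f vanish (ℕₚ.≤-pred m<1+n)) (vanish m<1+n) ⟩
    ∑ m f + 0#          ≈⟨ +-identityʳ _ ⟩
    ∑ m f               ∎

  ∑-bound-irrelevant : ∀ {m n} f → (∀ {j} → m < j → f j ≈ 0#) → (∀ {j} → n < j → f j ≈ 0#) → ∑ m f ≈ ∑ n f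
  ∑-bound-irrelevant {m} {n} f vanishₘ vanishₙ with ℕₚ.≤-total m n
  ... | inj₁ m≤n = sym (∑-extend f vanishₘ m≤n)
  ... | inj₂ n≤m = ∑-extend f vanishₙ n≤m

  ∑-single : ∀ {m n} f → m ≤ n → (∀ {j} → j ≤ n → j ≢ m → f j ≈ 0#) → ∑ n f ≈ f m
  ∑-single {m} {zero}  f z≤n others = refl
  ∑-single {m} {suc n} f m≤1+n others with m ≟ suc n
  ... | yes ≡.refl = begin
    ∑ n f + f m   ≈⟨ +-congʳ (∑-zero n f (λ j≤n → others (ℕₚ.m≤n⇒m≤1+n j≤n) (ℕₚ.<⇒≢ (s≤s j≤n)))) ⟩
    0# + f m      ≈⟨ +-identityˡ _ ⟩
    f m           ∎
  ... | no m≢1+n = begin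
    ∑ n f + f (suc n)   ≈⟨ +-cong (∑-single f m≤n (λ j≤n → others (ℕₚ.m≤n⇒m≤1+n j≤n)))
                                  (others ℕₚ.≤-refl (m≢1+n ∘ ≡.sym)) ⟩
    f m + 0#            ≈⟨ +-identityʳ _ ⟩
    f m                 ∎
    where m≤n = ℕₚ.≤-pred (ℕₚ.≤∧≢⇒< m≤1+n m≢1+n)

  ∑-swap : ∀ m n (f : ℕ → ℕ → Carrier) → ∑[ i ≤ m ] ∑[ j ≤ n ] f i j ≈ ∑[ j ≤ n ] ∑[ i ≤ m ] f i j
  ∑-swap zero    n f = refl
  ∑-swap (suc m) n f = trans (+-congʳ (∑-swap m n f)) (sym (∑-+ n (λ j → ∑[ i ≤ m ] f i j) (f (suc m))))

  shift : (ℕ → Carrier) → ℕ → Carrier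
  shift v zero    = 0#
  shift v (suc k) = v k

  shift-cong : ∀ {u v} → (∀ j → u j ≈ v j) → ∀ k → shift u k ≈ shift v k
  shift-cong u≈v zero    = refl
  shift-cong u≈v (suc k) = u≈v k

  δ : ℕ → ℕ → Carrier
  δ zero    zero    = 1#
  δ zero    (suc n) = 0#
  δ (suc m) zero    = 0#
  δ (suc m) (suc n) = δ m n

  δ-diag : ∀ n → δ n n ≡ 1#
  δ-diag zero    = ≡.refl
  δ-diag (suc n) = δ-diag n

  δ-off : ∀ {m n} → m ≢ n → δ m n ≡ 0#
  δ-off {zero}  {zero}  m≢n = contradiction ≡.refl m≢n
  δ-off {zero}  {suc n} m≢n = ≡.refl
  δ-off {suc m} {zero}  m≢n = ≡.refl
  δ-off {suc m} {suc n} m≢n = δ-off (m≢n ∘ ≡.cong suc)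

  δ-above : ∀ {m n} → n < m → δ m n ≡ 0#
  δ-above = δ-off ∘ ℕₚ.>⇒≢

  δ-sym : ∀ m n → δ m n ≡ δ n m
  δ-sym zero    zero    = ≡.refl
  δ-sym zero    (suc n) = ≡.refl
  δ-sym (suc m) zero    = ≡.refl
  δ-sym (suc m) (suc n) = δ-sym m n

  ∑-δ : ∀ {m n} (u : ℕ → Carrier) → m ≤ n → ∑[ j ≤ n ] (δ m j * u j) ≈ u m
  ∑-δ {m} {n} u m≤n = begin
    ∑[ j ≤ n ] (δ m j * u j)   ≈⟨ ∑-single (λ j → δ m j * u j) m≤n (λ _ j≢m → δ-off≈ (j≢m ∘ ≡.sym)) ⟩
    δ m m * u m                ≈⟨ *-congʳ (reflexive (δ-diag m)) ⟩
    1# * u m                   ≈⟨ *-identityˡ (u m) ⟩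
    u m                        ∎
    where
    δ-off≈ : ∀ {j} → m ≢ j → δ m j * u j ≈ 0#
    δ-off≈ m≢j = trans (*-congʳ (reflexive (δ-off m≢j))) (zeroˡ _)

  ∑-δ-suc : ∀ {m n} (u : ℕ → Carrier) → m ≤ n → ∑[ j ≤ n ] (δ m (suc j) * u j) ≈ shift u m
  ∑-δ-suc {zero}  {n} u _   = ∑-zero n _ (λ _ → zeroˡ _)
  ∑-δ-suc {suc m}     u m<n = ∑-δ u (ℕₚ.<⇒≤ m<n)

  ∑-δ-2+ : ∀ {m n} (u : ℕ → Carrier) → m ≤ n → ∑[ j ≤ n ] (δ m (suc (suc j)) * u j) ≈ shift (shift u) m
  ∑-δ-2+ {zero}  {n} u _   = ∑-zero n _ (λ _ → zeroˡ _)
  ∑-δ-2+ {suc m}     u m<n = ∑-δ-suc u (ℕₚ.<⇒≤ m<n)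

  module _ (f₁ f₀ f₋₁ f₋₂ : ℕ → Carrier) where

    band-δ : ∀ n k → band R f₁ f₀ f₋₁ f₋₂ n k ≈
      δ k (suc n) * f₁ n + δ k n * f₀ n + δ (suc k) n * f₋₁ n + δ (suc (suc k)) n * f₋₂ n
    band-δ n k with k ≟ suc n
    ... | yes ≡.refl
      rewrite δ-diag n | δ-above (ℕₚ.n<1+n n) | δ-above (ℕₚ.m<n⇒m<1+n (ℕₚ.n<1+n n))
            | δ-above (ℕₚ.m<n⇒m<1+n (ℕₚ.m<n⇒m<1+n (ℕₚ.n<1+n n)))
      = solve 4 (λ a b c d → a := con 1 :* a :+ con 0 :* b :+ con 0 :* c :+ con 0 :* d) refl _ _ _ _
    ... | no k≢1+n with k ≟ n
    ...   | yes ≡.refl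
      rewrite δ-off k≢1+n | δ-diag k | δ-above (ℕₚ.n<1+n k) | δ-above (ℕₚ.m<n⇒m<1+n (ℕₚ.n<1+n k))
      = solve 4 (λ a b c d → b := con 0 :* a :+ con 1 :* b :+ con 0 :* c :+ con 0 :* d) refl _ _ _ _
    ...   | no k≢n with suc k ≟ n
    ...     | yes ≡.refl
      rewrite δ-off k≢1+n | δ-off k≢n | δ-diag k | δ-above (ℕₚ.n<1+n k)
      = solve 4 (λ a b c d → c := con 0 :* a :+ con 0 :* b :+ con 1 :* c :+ con 0 :* d) refl _ _ _ _
    ...     | no 1+k≢n with suc (suc k) ≟ n
    ...       | yes ≡.refl
      rewrite δ-off k≢1+n | δ-off k≢n | δ-off 1+k≢n | δ-diag k
      = solve 4 (λ a b c d → d := con 0 :* a :+ con 0 :* b :+ con 0 :* c :+ con 1 :* d) refl _ _ _ _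
    ...       | no 2+k≢n
      rewrite δ-off k≢1+n | δ-off k≢n | δ-off 1+k≢n | δ-off 2+k≢n
      = solve 4 (λ a b c d → con 0 := con 0 :* a :+ con 0 :* b :+ con 0 :* c :+ con 0 :* d) refl _ _ _ _

    private
      B : ℕ → ℕ → Carrier
      B = band R f₁ f₀ f₋₁ f₋₂

      ∑-+₄ : ∀ n (a b c d : ℕ → Carrier) →
        ∑[ j ≤ n ] (a j + b j + c j + d j) ≈ ∑ n a + ∑ n b + ∑ n c + ∑ n d
      ∑-+₄ n a b c d = trans (∑-+ n _ d) (+-congʳ (trans (∑-+ n _ c) (+-congʳ (∑-+ n a b))))

    band-columnSum : ∀ n (v : ℕ → Carrier) → (∀ {j} → n < j → v j ≈ 0#) → ∀ k →
      ∑[ j ≤ n ] (v j * B j k) ≈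
        shift (λ j → v j * f₁ j) k + v k * f₀ k + v (suc k) * f₋₁ (suc k) + v (suc (suc k)) * f₋₂ (suc (suc k))
    band-columnSum n v vanish k = begin
      ∑[ j ≤ n ] (v j * B j k)
        ≈⟨ ∑-extend (λ j → v j * B j k) (λ n<j → trans (*-congʳ (vanish n<j)) (zeroˡ _)) n≤M ⟨
      ∑[ j ≤ M ] (v j * B j k)
        ≈⟨ ∑-cong M (λ {j} _ → trans (*-congˡ (band-δ j k)) (spread j)) ⟩
      ∑[ j ≤ M ] (δ k (suc j) * (v j * f₁ j) + δ k j * (v j * f₀ j)
                 + δ (suc k) j * (v j * f₋₁ j) + δ (suc (suc k)) j * (v j * f₋₂ j))
        ≈⟨ ∑-+₄ M _ _ _ _ ⟩
      _ ≈⟨ +-cong (+-cong (+-cong (∑-δ-suc _ k≤M) (∑-δ _ k≤M)) (∑-δ _ 1+k≤M)) (∑-δ _ 2+k≤M) ⟩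
      shift (λ j → v j * f₁ j) k + v k * f₀ k + v (suc k) * f₋₁ (suc k) + v (suc (suc k)) * f₋₂ (suc (suc k)) ∎
      where
      M = suc (suc k) ℕ.+ n
      n≤M : n ≤ M
      n≤M = ℕₚ.m≤n+m n (suc (suc k))
      2+k≤M : suc (suc k) ≤ M
      2+k≤M = ℕₚ.m≤m+n (suc (suc k)) n
      1+k≤M : suc k ≤ M
      1+k≤M = ℕₚ.<⇒≤ 2+k≤M
      k≤M : k ≤ M
      k≤M = ℕₚ.<⇒≤ 1+k≤M
      spread : ∀ j → v j * (δ k (suc j) * f₁ j + δ k j * f₀ j + δ (suc k) j * f₋₁ j + δ (suc (suc k)) j * f₋₂ j) ≈
        δ k (suc j) * (v j * f₁ j) + δ k j * (v j * f₀ j) + δ (suc k) j * (v j * f₋₁ j) + δ (suc (suc k)) j * (v j * f₋₂ j)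
      spread j = solve 9 (λ x d₁ d₂ d₃ d₄ a b c e →
        x :* (d₁ :* a :+ d₂ :* b :+ d₃ :* c :+ d₄ :* e)
          := d₁ :* (x :* a) :+ d₂ :* (x :* b) :+ d₃ :* (x :* c) :+ d₄ :* (x :* e))
        refl (v j) _ _ _ _ (f₁ j) (f₀ j) (f₋₁ j) (f₋₂ j)

    band-rowSum : ∀ i (h : ℕ → Carrier) →
      ∑[ l ≤ suc i ] (B i l * h l) ≈ f₁ i * h (suc i) + f₀ i * h i + f₋₁ i * shift h i + f₋₂ i * shift (shift h) i
    band-rowSum i h = begin
      ∑[ l ≤ suc i ] (B i l * h l)
        ≈⟨ ∑-cong (suc i) (λ {l} _ → trans (*-congʳ (band-δ i l)) (gather l)) ⟩
      ∑[ l ≤ suc i ] (f₁ i * (δ (suc i) l * h l) + f₀ i * (δ i l * h l)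
                     + f₋₁ i * (δ i (suc l) * h l) + f₋₂ i * (δ i (suc (suc l)) * h l))
        ≈⟨ ∑-+₄ (suc i) _ _ _ _ ⟩
      _ ≈⟨ +-cong (+-cong (+-cong (pull (f₁ i) (∑-δ h ℕₚ.≤-refl)) (pull (f₀ i) (∑-δ h (ℕₚ.n≤1+n i))))
                          (pull (f₋₁ i) (∑-δ-suc h (ℕₚ.n≤1+n i)))) (pull (f₋₂ i) (∑-δ-2+ h (ℕₚ.n≤1+n i))) ⟩
      f₁ i * h (suc i) + f₀ i * h i + f₋₁ i * shift h i + f₋₂ i * shift (shift h) i ∎
      where
      pull : ∀ a {g : ℕ → Carrier} {r} → ∑ (suc i) g ≈ r → ∑[ l ≤ suc i ] (a * g l) ≈ a * r
      pull a {g} ∑g≈r = trans (sym (∑-*ˡ (suc i) a g)) (*-congˡ ∑g≈r)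
      gather : ∀ l → (δ l (suc i) * f₁ i + δ l i * f₀ i + δ (suc l) i * f₋₁ i + δ (suc (suc l)) i * f₋₂ i) * h l ≈
        f₁ i * (δ (suc i) l * h l) + f₀ i * (δ i l * h l) + f₋₁ i * (δ i (suc l) * h l) + f₋₂ i * (δ i (suc (suc l)) * h l)
      gather l rewrite δ-sym l (suc i) | δ-sym l i | δ-sym (suc l) i | δ-sym (suc (suc l)) i =
        solve 9 (λ x d₁ d₂ d₃ d₄ a b c e →
          (d₁ :* a :+ d₂ :* b :+ d₃ :* c :+ d₄ :* e) :* x
            := a :* (d₁ :* x) :+ b :* (d₂ :* x) :+ c :* (d₃ :* x) :+ e :* (d₄ :* x))
          refl (h l) _ _ _ _ (f₁ i) (f₀ i) (f₋₁ i) (f₋₂ i)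

  LowerTriangular : Matrix R → Set ℓ
  LowerTriangular A = ∀ {n k} → n < k → A n k ≈ 0#

  ProductionRecurrence : Matrix R → Matrix R → Set ℓ
  ProductionRecurrence P A = ∀ n k → A (suc n) k ≈ ∑[ j ≤ n ] (A n j * P j k)

  maxTo-≥ : ∀ s (b : ℕ → ℕ) {i} → i ≤ s → b i ≤ maxTo R s b
  maxTo-≥ zero    b z≤n = ℕₚ.≤-refl
  maxTo-≥ (suc s) b {i} i≤1+s with i ≟ suc s
  ... | yes ≡.refl = ℕₚ.m≤n⊔m (maxTo R s b) (b (suc s))
  ... | no i≢1+s  = ℕₚ.≤-trans (maxTo-≥ s b (ℕₚ.≤-pred (ℕₚ.≤∧≢⇒< i≤1+s i≢1+s))) (ℕₚ.m≤m⊔n _ _)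

  row0Pow-vanish : ∀ P n {j} → proj₁ (row0Pow R P n) < j → proj₂ (row0Pow R P n) j ≈ 0#
  row0Pow-vanish P zero    {suc j} _ = refl
  row0Pow-vanish P (suc n) {j} s<j with row0Pow R P n
  ... | s , v = ∑-zero s _ (λ {i} i≤s →
    trans (*-congˡ (vanish P i j (ℕₚ.≤-<-trans (maxTo-≥ s (bound P) i≤s) s<j))) (zeroʳ _))

  production-by-recurrence : ∀ P (A : Matrix R) → A 0 0 ≈ 1# → LowerTriangular A →
    ProductionRecurrence (entry P) A → IsProductionMatrixOf R P A
  production-by-recurrence P A A₀₀≈1 lowerA recA = rows
    where
    rows : ∀ n k → output R P n k ≈ A n k
    rows zero    zero    = sym A₀₀≈1
    rows zero    (suc k) = sym (lowerA (s≤s z≤n))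
    rows (suc n) k with row0Pow R P n | row0Pow-vanish P n | rows n
    ... | s , v | v-vanish | v≈A = begin
      ∑[ j ≤ s ] (v j * entry P j k)     ≈⟨ ∑-cong s (λ {j} _ → *-congʳ (v≈A j)) ⟩
      ∑[ j ≤ s ] (A n j * entry P j k)
        ≈⟨ ∑-bound-irrelevant _ (λ s<j → trans (*-congʳ (trans (sym (v≈A _)) (v-vanish s<j))) (zeroˡ _))
                                (λ n<j → trans (*-congʳ (lowerA n<j)) (zeroˡ _)) ⟩
      ∑[ j ≤ n ] (A n j * entry P j k)   ≈⟨ recA n k ⟨
      A (suc n) k                        ∎

  lowerMul-lowerTriangular : ∀ (A : Matrix R) {B} → LowerTriangular B → LowerTriangular (lowerMul R A B)
  lowerMul-lowerTriangular A lowerB {n} n<k =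
    ∑-zero n _ (λ j≤n → trans (*-congˡ (lowerB (ℕₚ.≤-<-trans j≤n n<k))) (zeroʳ _))

  lowerMul-recurrence : ∀ {P Q A B : Matrix R} → LowerTriangular B → (∀ {i l} → suc i < l → P i l ≈ 0#) →
    ProductionRecurrence P A →
    (∀ i k → ∑[ l ≤ suc i ] (P i l * B l k) ≈ ∑[ j ≤ i ] (B i j * Q j k)) →
    ProductionRecurrence Q (lowerMul R A B)
  lowerMul-recurrence {P} {Q} {A} {B} lowerB upperP recA PB≈BQ n k = begin
    ∑[ l ≤ suc n ] (A (suc n) l * B l k)
      ≈⟨ ∑-cong (suc n) (λ {l} _ → trans (*-congʳ (recA n l)) (trans (∑-*ʳ n _ _) (∑-cong n (λ _ → *-assoc _ _ _)))) ⟩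
    ∑[ l ≤ suc n ] ∑[ i ≤ n ] (A n i * (P i l * B l k))
      ≈⟨ ∑-swap (suc n) n _ ⟩
    ∑[ i ≤ n ] ∑[ l ≤ suc n ] (A n i * (P i l * B l k))
      ≈⟨ ∑-cong n (λ {i} i≤n → trans (sym (∑-*ˡ (suc n) _ _)) (*-congˡ (PB≈BQ-upto i≤n))) ⟩
    ∑[ i ≤ n ] (A n i * ∑[ j ≤ n ] (B i j * Q j k))
      ≈⟨ ∑-cong n (λ _ → ∑-*ˡ n _ _) ⟩
    ∑[ i ≤ n ] ∑[ j ≤ n ] (A n i * (B i j * Q j k))
      ≈⟨ ∑-swap n n _ ⟩
    ∑[ j ≤ n ] ∑[ i ≤ n ] (A n i * (B i j * Q j k))
      ≈⟨ ∑-cong n (λ _ → trans (∑-cong n (λ _ → sym (*-assoc _ _ _))) (sym (∑-*ʳ n _ _))) ⟩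
    ∑[ j ≤ n ] (lowerMul R A B n j * Q j k) ∎
    where
    PB≈BQ-upto : ∀ {i} → i ≤ n → ∑[ l ≤ suc n ] (P i l * B l k) ≈ ∑[ j ≤ n ] (B i j * Q j k)
    PB≈BQ-upto {i} i≤n = begin
      ∑[ l ≤ suc n ] (P i l * B l k) ≈⟨ ∑-extend _ (λ 1+i<l → trans (*-congʳ (upperP 1+i<l)) (zeroˡ _)) (s≤s i≤n) ⟩
      ∑[ l ≤ suc i ] (P i l * B l k) ≈⟨ PB≈BQ i k ⟩
      ∑[ j ≤ i ] (B i j * Q j k)     ≈⟨ ∑-extend _ (λ i<j → trans (*-congʳ (lowerB i<j)) (zeroˡ _)) i≤n ⟨
      ∑[ j ≤ n ] (B i j * Q j k)     ∎

  -- Matrices with entries C(n,k) g n (n-k) for every k (the binomial kills the entries above the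
  -- diagonal), whose entries along a row have ratio g n (m+1) = g n m * w (n-m).
  module BinomialMatrix (M : Matrix R) (g : ℕ → ℕ → Carrier) (w : ℕ → Carrier)
    (M-entry : ∀ n k → M n k ≈ ι (n C k) * g n (n ∸ k))
    (g-step : ∀ {n k} → k < n → g n (suc (n ∸ suc k)) ≈ g n (n ∸ suc k) * w (suc k)) where

    lowerTriangular : LowerTriangular M
    lowerTriangular {n} {k} n<k = begin
      M n k                     ≈⟨ M-entry n k ⟩
      ι (n C k) * g n (n ∸ k)   ≈⟨ *-congʳ (ι-binomial-above n<k) ⟩
      0# * g n (n ∸ k)          ≈⟨ zeroˡ _ ⟩
      0#                        ∎

    entry-suc : ∀ n k → M n (suc k) * w (suc k) ≈ ι (n C suc k) * g n (n ∸ k)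
    entry-suc n k with ℕₚ.<-≤-connex k n
    ... | inj₁ k<n = begin
      M n (suc k) * w (suc k)                         ≈⟨ *-congʳ (M-entry n (suc k)) ⟩
      ι (n C suc k) * g n (n ∸ suc k) * w (suc k)     ≈⟨ *-assoc _ _ _ ⟩
      ι (n C suc k) * (g n (n ∸ suc k) * w (suc k))   ≈⟨ *-congˡ (g-step k<n) ⟨
      ι (n C suc k) * g n (suc (n ∸ suc k))           ≈⟨ *-congˡ (reflexive (≡.cong (g n) (k<n⇒n∸k≡1+[n∸1+k] k<n))) ⟨
      ι (n C suc k) * g n (n ∸ k)                     ∎
    ... | inj₂ n≤k = begin
      M n (suc k) * w (suc k)        ≈⟨ *-congʳ (lowerTriangular n<1+k) ⟩
      0# * w (suc k)                 ≈⟨ zeroˡ _ ⟩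
      0#                             ≈⟨ zeroˡ _ ⟨
      0# * g n (n ∸ k)               ≈⟨ *-congʳ (ι-binomial-above n<1+k) ⟨
      ι (n C suc k) * g n (n ∸ k)    ∎
      where n<1+k = s≤s n≤k

    weighted : ∀ n k → ι (suc k) * w (suc k) * M n (suc k) + ι k * M n k ≈ ι n * M n k
    weighted n k = begin
      ι (suc k) * w (suc k) * M n (suc k) + ι k * M n k
        ≈⟨ +-cong (trans (*-assoc _ _ _) (*-congˡ (trans (*-comm _ _) (entry-suc n k)))) (*-congˡ (M-entry n k)) ⟩
      ι (suc k) * (ι (n C suc k) * G) + ι k * (ι (n C k) * G)
        ≈⟨ solve 5 (λ a c₁ b c₀ G → a :* (c₁ :* G) :+ b :* (c₀ :* G) := (a :* c₁ :+ b :* c₀) :* G) refl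
                 (ι (suc k)) (ι (n C suc k)) (ι k) (ι (n C k)) G ⟩
      (ι (suc k) * ι (n C suc k) + ι k * ι (n C k)) * G
        ≈⟨ *-congʳ (ι-binomial-weighted n k) ⟩
      ι n * ι (n C k) * G
        ≈⟨ *-assoc _ _ _ ⟩
      ι n * (ι (n C k) * G)
        ≈⟨ *-congˡ (M-entry n k) ⟨
      ι n * M n k ∎
      where G = g n (n ∸ k)

  falling-cong : ∀ {y y′} m → y ≈ y′ → falling R y m ≈ falling R y′ m
  falling-cong zero    y≈y′ = refl
  falling-cong (suc m) y≈y′ = *-cong (falling-cong m y≈y′) (+-congʳ y≈y′)

  [x+y]-[x+z]≈y-z : ∀ x y z → (x + y) - (x + z) ≈ y - z
  [x+y]-[x+z]≈y-z x y z = begin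
    (x + y) + - (x + z)      ≈⟨ +-congˡ (⁻¹-∙-comm x z) ⟨
    (x + y) + (- x + - z)    ≈⟨ solve 4 (λ x y x⁻ z⁻ → (x :+ y) :+ (x⁻ :+ z⁻) := (x :+ x⁻) :+ (y :+ z⁻))
                                      refl x y (- x) (- z) ⟩
    (x + - x) + (y + - z)    ≈⟨ +-congʳ (-‿inverseʳ x) ⟩
    0# + (y - z)             ≈⟨ +-identityˡ _ ⟩
    y - z                    ∎

  falling-shift : ∀ y m → falling R (1# + y) (suc m) ≈ (1# + y) * falling R y m
  falling-shift y zero = begin
    1# * ((1# + y) - 0#)   ≈⟨ *-identityˡ _ ⟩
    (1# + y) - 0#          ≈⟨ +-congˡ ε⁻¹≈ε ⟩
    (1# + y) + 0#          ≈⟨ +-identityʳ _ ⟩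
    1# + y                 ≈⟨ *-identityʳ _ ⟨
    (1# + y) * 1#          ∎
  falling-shift y (suc m) = begin
    falling R (1# + y) (suc m) * ((1# + y) - (1# + ι m))   ≈⟨ *-cong (falling-shift y m) ([x+y]-[x+z]≈y-z 1# y (ι m)) ⟩
    (1# + y) * falling R y m * (y - ι m)                   ≈⟨ *-assoc _ _ _ ⟩
    (1# + y) * (falling R y m * (y - ι m))                 ∎

  ι-∸-cancel : ∀ a {m n} → m ≤ n → (ι n + a) - ι (n ∸ m) ≈ ι m + a
  ι-∸-cancel a {m} {n} m≤n = begin
    (ι n + a) - ι (n ∸ m)                 ≈⟨ +-congʳ (+-congʳ (ι-cong (ℕₚ.m∸n+n≡m m≤n))) ⟨
    (ι (n ∸ m ℕ.+ m) + a) - ι (n ∸ m)     ≈⟨ +-congʳ (trans (+-congʳ (ι-+ (n ∸ m) m)) (+-assoc _ _ _)) ⟩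
    (ι (n ∸ m) + (ι m + a)) - ι (n ∸ m)   ≈⟨ xyx⁻¹≈y (ι (n ∸ m)) (ι m + a) ⟩
    ι m + a                               ∎

  module _ (α : Carrier) where
    private
      L : Matrix R
      L = Lα R α

    Lα-entry : ∀ n k → L n k ≈ ι (n C k) * falling R (ι n + α) (n ∸ k)
    Lα-entry n k with k ≤? n
    ... | yes _  = refl
    ... | no k≰n = sym (trans (*-congʳ (ι-binomial-above (ℕₚ.≰⇒> k≰n))) (zeroˡ _))

    Lα-falling-step : ∀ {n k} → k < n →
      falling R (ι n + α) (suc (n ∸ suc k)) ≈ falling R (ι n + α) (n ∸ suc k) * (ι (suc k) + α)
    Lα-falling-step k<n = *-congˡ (ι-∸-cancel α k<n)

    module Lα-binomial = BinomialMatrix L (λ n → falling R (ι n + α)) (λ j → ι j + α) Lα-entry Lα-falling-step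

    Lα₀₀≈1 : L 0 0 ≈ 1#
    Lα₀₀≈1 = trans (*-identityʳ _) (+-identityʳ 1#)

    Lα-pascal : ∀ n k → L (suc n) k ≈ shift (L n) k + (ι n + ι k + 1# + α) * L n k
    Lα-pascal n zero = begin
      L (suc n) 0
        ≈⟨ Lα-entry (suc n) 0 ⟩
      ι 1 * falling R (ι (suc n) + α) (suc n)
        ≈⟨ *-congˡ (trans (falling-cong (suc n) (+-assoc _ _ _)) (falling-shift y n)) ⟩
      ι 1 * ((1# + y) * falling R y n)
        ≈⟨ solve 3 (λ N a F → (con 1 :+ con 0) :* ((con 1 :+ (N :+ a)) :* F)
                    := con 0 :+ (N :+ con 0 :+ con 1 :+ a) :* ((con 1 :+ con 0) :* F)) refl (ι n) α _ ⟩
      0# + (ι n + ι 0 + 1# + α) * (ι 1 * falling R y n)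
        ≈⟨ +-congˡ (*-congˡ (Lα-entry n 0)) ⟨
      shift (L n) 0 + (ι n + ι 0 + 1# + α) * L n 0 ∎
      where y = ι n + α
    Lα-pascal n (suc k) with ℕₚ.<-≤-connex k n
    ... | inj₁ k<n = begin
      L (suc n) (suc k)
        ≈⟨ Lα-entry (suc n) (suc k) ⟩
      ι (suc n C suc k) * falling R (ι (suc n) + α) (n ∸ k)
        ≈⟨ *-cong (ι-binomial-pascal n k) (falling-cong (n ∸ k) (+-assoc _ _ _)) ⟩
      (c₀ + c₁) * falling R (1# + y) (n ∸ k)
        ≈⟨ *-congˡ (trans (reflexive (≡.cong (falling R (1# + y)) (k<n⇒n∸k≡1+[n∸1+k] k<n))) (falling-shift y j)) ⟩
      (c₀ + c₁) * ((1# + y) * F)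
        ≈⟨ solve 5 (λ c₀ c₁ N a F → (c₀ :+ c₁) :* ((con 1 :+ (N :+ a)) :* F)
                    := N :* c₀ :* F :+ (c₀ :* (F :* (con 1 :+ a)) :+ (N :+ con 1 :+ a) :* (c₁ :* F))) refl c₀ c₁ (ι n) α F ⟩
      ι n * c₀ * F + (c₀ * (F * (1# + α)) + (ι n + 1# + α) * (c₁ * F))
        ≈⟨ +-congʳ (*-congʳ (ι-binomial-weighted n k)) ⟨
      (ι (suc k) * c₁ + ι k * c₀) * F + (c₀ * (F * (1# + α)) + (ι n + 1# + α) * (c₁ * F))
        ≈⟨ solve 6 (λ c₀ c₁ K N a F →
                      ((con 1 :+ K) :* c₁ :+ K :* c₀) :* F :+ (c₀ :* (F :* (con 1 :+ a)) :+ (N :+ con 1 :+ a) :* (c₁ :* F))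
                    := c₀ :* (F :* ((con 1 :+ K) :+ a)) :+ (N :+ (con 1 :+ K) :+ con 1 :+ a) :* (c₁ :* F))
                 refl c₀ c₁ (ι k) (ι n) α F ⟩
      c₀ * (F * (ι (suc k) + α)) + (ι n + ι (suc k) + 1# + α) * (c₁ * F)
        ≈⟨ +-cong (trans (Lα-entry n k) (*-congˡ L₀-falling)) (*-congˡ (Lα-entry n (suc k))) ⟨
      L n k + (ι n + ι (suc k) + 1# + α) * L n (suc k) ∎
      where
      y = ι n + α
      j = n ∸ suc k
      F = falling R y j
      c₀ = ι (n C k)
      c₁ = ι (n C suc k)
      L₀-falling : falling R y (n ∸ k) ≈ F * (ι (suc k) + α)
      L₀-falling = trans (reflexive (≡.cong (falling R y) (k<n⇒n∸k≡1+[n∸1+k] k<n))) (Lα-falling-step k<n)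
    ... | inj₂ n≤k = begin
      L (suc n) (suc k)
        ≈⟨ Lα-entry (suc n) (suc k) ⟩
      ι (suc n C suc k) * falling R (ι (suc n) + α) (n ∸ k)
        ≈⟨ *-cong (trans (ι-binomial-pascal n k) (+-congˡ (ι-binomial-above n<1+k)))
                  (reflexive (≡.cong (falling R _) n∸k≡0)) ⟩
      (c₀ + 0#) * 1#
        ≈⟨ solve 2 (λ c₀ a → (c₀ :+ con 0) :* con 1 := c₀ :* con 1 :+ a :* con 0) refl c₀ (ι n + ι (suc k) + 1# + α) ⟩
      c₀ * 1# + (ι n + ι (suc k) + 1# + α) * 0#
        ≈⟨ +-cong (trans (Lα-entry n k) (*-congˡ (reflexive (≡.cong (falling R _) n∸k≡0))))
                  (*-congˡ (Lα-binomial.lowerTriangular n<1+k)) ⟨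
      L n k + (ι n + ι (suc k) + 1# + α) * L n (suc k) ∎
      where
      c₀ = ι (n C k)
      n<1+k = s≤s n≤k
      n∸k≡0 = ℕₚ.m≤n⇒m∸n≡0 n≤k

    Lα-recurrence : ProductionRecurrence (entry (Pcirc R α)) L
    Lα-recurrence n k = begin
      L (suc n) k
        ≈⟨ Lα-pascal n k ⟩
      shift (L n) k + (ι n + ι k + 1# + α) * L₀
        ≈⟨ +-congˡ (solve 4 (λ N K a l → (N :+ K :+ con 1 :+ a) :* l := N :* l :+ (K :+ con 1 :+ a) :* l)
                            refl (ι n) (ι k) α L₀) ⟩
      shift (L n) k + (ι n * L₀ + (ι k + 1# + α) * L₀)
        ≈⟨ +-congˡ (+-congʳ (Lα-binomial.weighted n k)) ⟨
      shift (L n) k + (ι (suc k) * (ι (suc k) + α) * L₁ + ι k * L₀ + (ι k + 1# + α) * L₀)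
        ≈⟨ +-cong (shift-cong (λ _ → *-identityʳ _) k)
                  (solve 5 (λ K a l₀ l₁ l₂ →
                                l₀ :* (K :+ K :+ con 1 :+ a) :+ l₁ :* ((con 1 :+ K) :* ((con 1 :+ K) :+ a)) :+ l₂ :* con 0
                              := (con 1 :+ K) :* ((con 1 :+ K) :+ a) :* l₁ :+ K :* l₀ :+ (K :+ con 1 :+ a) :* l₀)
                           refl (ι k) α L₀ L₁ L₂) ⟨
      shift (λ j → L n j * 1#) k + (L₀ * (ι k + ι k + 1# + α) + L₁ * (ι (suc k) * (ι (suc k) + α)) + L₂ * 0#)
        ≈⟨ +-congˡ (+-congʳ (+-congʳ (*-congˡ (+-congʳ (ι-2*+1 k))))) ⟨
      shift (λ j → L n j * 1#) k + (L₀ * (ι (2 ℕ.* k ℕ.+ 1) + α) + L₁ * (ι (suc k) * (ι (suc k) + α)) + L₂ * 0#)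
        ≈⟨ solve 4 (λ s a b c → s :+ (a :+ b :+ c) := s :+ a :+ b :+ c) refl _ _ _ _ ⟩
      shift (λ j → L n j * 1#) k + L₀ * (ι (2 ℕ.* k ℕ.+ 1) + α) + L₁ * (ι (suc k) * (ι (suc k) + α)) + L₂ * 0#
        ≈⟨ band-columnSum _ _ _ _ n (L n) Lα-binomial.lowerTriangular k ⟨
      ∑[ j ≤ n ] (L n j * entry (Pcirc R α) j k) ∎
      where
      L₀ = L n k
      L₁ = L n (suc k)
      L₂ = L n (suc (suc k))

  module _ (x : Carrier) where
    private
      B : Matrix R
      B = Bx R x

    Bx-entry : ∀ n k → B n k ≈ ι (n C k) * pow R x (n ∸ k)
    Bx-entry n k with k ≤? n
    ... | yes _  = refl
    ... | no k≰n = sym (trans (*-congʳ (ι-binomial-above (ℕₚ.≰⇒> k≰n))) (zeroˡ _))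

    module Bx-binomial = BinomialMatrix B (λ _ → pow R x) (λ _ → x) Bx-entry (λ _ → refl)

    Bx₀₀≈1 : B 0 0 ≈ 1#
    Bx₀₀≈1 = trans (*-identityʳ _) (+-identityʳ 1#)

    Bx-pascal : ∀ n k → B (suc n) k ≈ shift (B n) k + x * B n k
    Bx-pascal n zero = begin
      B (suc n) 0                  ≈⟨ Bx-entry (suc n) 0 ⟩
      ι 1 * (pow R x n * x)        ≈⟨ solve 2 (λ p x → (con 1 :+ con 0) :* (p :* x) := con 0 :+ x :* ((con 1 :+ con 0) :* p))
                                            refl (pow R x n) x ⟩
      0# + x * (ι 1 * pow R x n)   ≈⟨ +-congˡ (*-congˡ (Bx-entry n 0)) ⟨
      shift (B n) 0 + x * B n 0    ∎
    Bx-pascal n (suc k) = begin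
      B (suc n) (suc k)                                      ≈⟨ Bx-entry (suc n) (suc k) ⟩
      ι (suc n C suc k) * pow R x (n ∸ k)                    ≈⟨ *-congʳ (ι-binomial-pascal n k) ⟩
      (ι (n C k) + ι (n C suc k)) * pow R x (n ∸ k)          ≈⟨ distribʳ _ _ _ ⟩
      ι (n C k) * pow R x (n ∸ k) + ι (n C suc k) * pow R x (n ∸ k)
        ≈⟨ +-cong (Bx-entry n k) (trans (*-comm _ _) (Bx-binomial.entry-suc n k)) ⟨
      B n k + x * B n (suc k)                                ∎

    Bx-absorb : ∀ i k → ι (suc k) * B i (suc k) ≈ ι i * shift (λ l → B l k) i
    Bx-absorb zero k = begin
      ι (suc k) * B 0 (suc k)   ≈⟨ *-congˡ (Bx-binomial.lowerTriangular {0} {suc k} (s≤s z≤n)) ⟩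
      ι (suc k) * 0#            ≈⟨ zeroʳ _ ⟩
      0#                        ≈⟨ zeroˡ 0# ⟨
      0# * 0#                   ∎
    Bx-absorb (suc i) k = begin
      ι (suc k) * B (suc i) (suc k)                      ≈⟨ *-congˡ (Bx-entry (suc i) (suc k)) ⟩
      ι (suc k) * (ι (suc i C suc k) * pow R x (i ∸ k))  ≈⟨ *-assoc _ _ _ ⟨
      ι (suc k) * ι (suc i C suc k) * pow R x (i ∸ k)    ≈⟨ *-congʳ (ι-binomial-absorb i k) ⟩
      ι (suc i) * ι (i C k) * pow R x (i ∸ k)            ≈⟨ *-assoc _ _ _ ⟩
      ι (suc i) * (ι (i C k) * pow R x (i ∸ k))          ≈⟨ *-congˡ (Bx-entry i k) ⟨
      ι (suc i) * B i k                                  ∎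

  module _ (α x : Carrier) where
    private
      B : Matrix R
      B = Bx R x

    Pcirc-Bx-entry : ∀ i k → ∑[ l ≤ suc i ] (entry (Pcirc R α) i l * B l k) ≈
      shift (B i) k + (x + 1# + α) * B i k + (ι i * B i k + ι i * B i k) + (ι i + α) * (ι (suc k) * B i (suc k))
    Pcirc-Bx-entry i k = begin
      ∑[ l ≤ suc i ] (entry (Pcirc R α) i l * B l k)
        ≈⟨ band-rowSum _ _ _ _ i (λ l → B l k) ⟩
      1# * B (suc i) k + (ι (2 ℕ.* i ℕ.+ 1) + α) * B₀ + I * (I + α) * T + 0# * shift (shift (λ l → B l k)) i
        ≈⟨ +-congʳ (+-congʳ (+-cong (*-congˡ (Bx-pascal x i k)) (*-congʳ (+-congʳ (ι-2*+1 i))))) ⟩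
      1# * (S + x * B₀) + (I + I + 1# + α) * B₀ + I * (I + α) * T + 0# * shift (shift (λ l → B l k)) i
        ≈⟨ solve 7 (λ S x B₀ I a T T₂ →
                      con 1 :* (S :+ x :* B₀) :+ (I :+ I :+ con 1 :+ a) :* B₀ :+ I :* (I :+ a) :* T :+ con 0 :* T₂
                    := S :+ (x :+ con 1 :+ a) :* B₀ :+ (I :* B₀ :+ I :* B₀) :+ (I :+ a) :* (I :* T)) refl S x B₀ I α T _ ⟩
      S + (x + 1# + α) * B₀ + (I * B₀ + I * B₀) + (I + α) * (I * T)
        ≈⟨ +-congˡ (*-congˡ (Bx-absorb x i k)) ⟨
      S + (x + 1# + α) * B₀ + (I * B₀ + I * B₀) + (I + α) * (ι (suc k) * B i (suc k)) ∎
      where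
      I = ι i
      S = shift (B i) k
      T = shift (λ l → B l k) i
      B₀ = B i k

    Bx-Pb-entry : ∀ i k → ∑[ j ≤ i ] (B i j * entry (Pb R α x) j k) ≈
      shift (B i) k + B i k * (ι k + ι k + 1# + α + x)
        + B i (suc k) * (ι (suc k) * (ι (suc k) + α) + (ι (suc k) + ι (suc k)) * x)
        + B i (suc (suc k)) * (ι (suc (suc k)) * ι (suc k) * x)
    Bx-Pb-entry i k = begin
      ∑[ j ≤ i ] (B i j * entry (Pb R α x) j k)
        ≈⟨ band-columnSum _ _ _ _ i (B i) (Bx-binomial.lowerTriangular x) k ⟩
      shift (λ j → B i j * 1#) k + B₀ * (ι (2 ℕ.* k ℕ.+ 1) + α + x)
        + B₁ * (ι (suc k) * (ι (suc k) + α) + ι (2 ℕ.* suc k) * x) + B₂ * (ι (suc (suc k) ℕ.* suc k) * x)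
        ≈⟨ +-cong (+-cong (+-cong (shift-cong (λ _ → *-identityʳ _) k) (*-congˡ (+-congʳ (+-congʳ (ι-2*+1 k)))))
                          (*-congˡ (+-congˡ (*-congʳ (ι-2* (suc k))))))
                  (*-congˡ (*-congʳ (ι-* (suc (suc k)) (suc k)))) ⟩
      shift (B i) k + B₀ * (ι k + ι k + 1# + α + x) + B₁ * (ι (suc k) * (ι (suc k) + α) + (ι (suc k) + ι (suc k)) * x)
        + B₂ * (ι (suc (suc k)) * ι (suc k) * x) ∎
      where
      B₀ = B i k
      B₁ = B i (suc k)
      B₂ = B i (suc (suc k))

    Pcirc-Bx≈Bx-Pb : ∀ i k → ∑[ l ≤ suc i ] (entry (Pcirc R α) i l * B l k) ≈ ∑[ j ≤ i ] (B i j * entry (Pb R α x) j k)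
    Pcirc-Bx≈Bx-Pb i k = begin
      ∑[ l ≤ suc i ] (entry (Pcirc R α) i l * B l k)
        ≈⟨ Pcirc-Bx-entry i k ⟩
      S + (x + 1# + α) * B₀ + (I * B₀ + I * B₀) + (I + α) * (ι (suc k) * B₁)
        ≈⟨ solve 7 (λ S x B₀ I a K B₁ →
                      S :+ (x :+ con 1 :+ a) :* B₀ :+ (I :* B₀ :+ I :* B₀) :+ (I :+ a) :* ((con 1 :+ K) :* B₁)
                    := S :+ (x :+ con 1 :+ a) :* B₀ :+ (I :* B₀ :+ I :* B₀) :+ (con 1 :+ K) :* (I :* B₁)
                         :+ a :* (con 1 :+ K) :* B₁)
                 refl S x B₀ I α (ι k) B₁ ⟩
      S + (x + 1# + α) * B₀ + (I * B₀ + I * B₀) + ι (suc k) * (I * B₁) + α * ι (suc k) * B₁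
        ≈⟨ +-congʳ (+-cong (+-congˡ (+-cong weighted₀ weighted₀)) (*-congˡ weighted₁)) ⟨
      S + (x + 1# + α) * B₀ + (W₀ + W₀) + ι (suc k) * W₁ + α * ι (suc k) * B₁
        ≈⟨ solve 7 (λ S x B₀ B₁ B₂ K a →
               S :+ (x :+ con 1 :+ a) :* B₀
                 :+ (((con 1 :+ K) :* x :* B₁ :+ K :* B₀) :+ ((con 1 :+ K) :* x :* B₁ :+ K :* B₀))
                 :+ (con 1 :+ K) :* ((con 1 :+ (con 1 :+ K)) :* x :* B₂ :+ (con 1 :+ K) :* B₁)
                 :+ a :* (con 1 :+ K) :* B₁
             := S :+ B₀ :* (K :+ K :+ con 1 :+ a :+ x)
                 :+ B₁ :* ((con 1 :+ K) :* ((con 1 :+ K) :+ a) :+ ((con 1 :+ K) :+ (con 1 :+ K)) :* x)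
                 :+ B₂ :* ((con 1 :+ (con 1 :+ K)) :* (con 1 :+ K) :* x))
             refl S x B₀ B₁ B₂ (ι k) α ⟩
      S + B₀ * (ι k + ι k + 1# + α + x) + B₁ * (ι (suc k) * (ι (suc k) + α) + (ι (suc k) + ι (suc k)) * x)
        + B₂ * (ι (suc (suc k)) * ι (suc k) * x)
        ≈⟨ Bx-Pb-entry i k ⟨
      ∑[ j ≤ i ] (B i j * entry (Pb R α x) j k) ∎
      where
      I = ι i
      S = shift (B i) k
      B₀ = B i k
      B₁ = B i (suc k)
      B₂ = B i (suc (suc k))
      W₀ = ι (suc k) * x * B₁ + ι k * B₀
      W₁ = ι (suc (suc k)) * x * B₂ + ι (suc k) * B₁
      weighted₀ : W₀ ≈ I * B₀
      weighted₀ = Bx-binomial.weighted x i k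
      weighted₁ : W₁ ≈ I * B₁
      weighted₁ = Bx-binomial.weighted x i (suc k)

proposition1p2 : ∀ {c ℓ} (R : CommutativeRing c ℓ) (α x : CommutativeRing.Carrier R) →
    IsProductionMatrixOf R (Pcirc R α) (Lα R α)
      × IsProductionMatrixOf R (Pb R α x) (lowerMul R (Lα R α) (Bx R x))
proposition1p2 R α x =
  production-by-recurrence R (Pcirc R α) L (Lα₀₀≈1 R α) lowerL recL ,
  production-by-recurrence R (Pb R α x) (lowerMul R L B) (trans (*-cong (Lα₀₀≈1 R α) (Bx₀₀≈1 R x)) (*-identityˡ 1#))
    (lowerMul-lowerTriangular R L lowerB)
    (lowerMul-recurrence R lowerB (vanish (Pcirc R α) _ _) recL (Pcirc-Bx≈Bx-Pb R α x))
  where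
  open CommutativeRing R using (trans; *-cong; *-identityˡ; 1#)
  L = Lα R α
  B = Bx R x
  lowerL = Lα-binomial.lowerTriangular R α
  lowerB = Bx-binomial.lowerTriangular R x
  recL = Lα-recurrence R α
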